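{- Let $\widehat{G}$ be a signed complete bigraph. Then $\widehat{G}$ is a chordal signed bigraph if and only if it does not contain any signed graph in $F_1\cup F_2\cup F_3\cup F_4$ as an induced subgraph.
   Context: A signed graph is a finite simple graph in which every edge is assigned a sign, positive or negative; an induced subgraph is obtained by deleting vertices, with signs inherited. "Contains a graph in a set $\mathcal{A}$ as an induced subgraph" means some induced subgraph is isomorphic, via a sign-preserving isomorphism, to a member of $\mathcal{A}$. A signed bigraph is a signed graph with bipartite underlying graph and fixed bipartition $(X,Y)$; it is a signed complete bigraph if the underlying graph is complete bipartite. A subgraph $H$ is a biclique if every vertex of $V(H)\cap X$ is adjacent to every vertex of $V(H)\cap Y$; it is positive if all its edges are positive. For an edge $uv$, $N(uv)=(N(u)\cup N(v))\setminus\{u,v\}$; $uv$ is signed simplicial if the subgraph induced by $N(uv)$ is a positive biclique. A signed bigraph is a chordal signed bigraph if its edges can be ordered $e_1,\dots,e_m$ so that each $e_i$ is signed simplicial in the signed bigraph obtained by deleting edges $e_1,\dots,e_{i-1}$ (keeping all vertices). The sets: $F_1$ consists of the single signed graph $K_{2,2}$ with all four edges negative. $F_2$: underlying graph $K_{2,3}$ with parts $\{a,b\}$, $\{p,q,r\}$, where $pa,aq,qb,br$ are negative and $bp,ar$ have arbitrary signs (all choices included). $F_3$: underlying $K_{2,4}$ with parts $\{a,b\}$, $\{p,q,r,s\}$, where $ap,aq,br,bs$ are negative and $bp,bq,ar,as$ have arbitrary signs. $F_4$: underlying $K_{3,3}$ with parts $\{a,b,c\}$, $\{p,q,r\}$,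 where $ap,bq,cr$ are negative and the other six edges have arbitrary signs. -}

module Defs where

open import Data.Nat using (ℕ)
open import Data.Fin using (Fin; zero; suc; _≟_)
open import Data.Maybe using (Maybe; just; nothing)
open import Data.Product using (Σ; ∃; _×_; _,_)
open import Data.Sum using (_⊎_; inj₁; inj₂)
open import Data.Unit using (⊤)
open import Data.List using (List; []; _∷_)
open import Data.List.Membership.Propositional using (_∈_)
open import Data.List.Relation.Unary.Unique.Propositional using (Unique)
open import Relation.Binary.PropositionalEquality using (_≡_; _≢_)
open import Relation.Nullary using (yes; no)
open import Function.Definitions using (Injective)

data Sign : Set where
  pos neg : Sign

-- A signed bigraph with fixed bipartition (X , Y) = (Fin m , Fin n):
-- E x y = nothing  : x and y are not adjacent
-- E x y = just s   : xy is an edge with sign s.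
-- (Edges only join X to Y, so the underlying graph is bipartite and simple.)
SBigraph : ℕ → ℕ → Set
SBigraph m n = Fin m → Fin n → Maybe Sign

IsEdge : Maybe Sign → Set
IsEdge e = ∃ λ (s : Sign) → e ≡ just s

Vtx : ℕ → ℕ → Set
Vtx m n = Fin m ⊎ Fin n

adj : ∀ {m n} → SBigraph m n → Vtx m n → Vtx m n → Maybe Sign
adj E (inj₁ x) (inj₂ y) = E x y
adj E (inj₂ y) (inj₁ x) = E x y
adj E (inj₁ _) (inj₁ _) = nothing
adj E (inj₂ _) (inj₂ _) = nothing

IsComplete : ∀ {m n} → SBigraph m n → Set
IsComplete {m} {n} E = (x : Fin m) (y : Fin n) → IsEdge (E x y)

deleteEdge : ∀ {m n} → SBigraph m n → Fin m × Fin n → SBigraph m n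
deleteEdge E (x , y) x' y' with x' ≟ x | y' ≟ y
... | yes _ | yes _ = nothing
... | _     | _     = E x' y'

-- Edge uv (u ∈ X, v ∈ Y) is signed simplicial: the subgraph induced by
-- N(uv) = (N(u) ∪ N(v)) \ {u , v} is a positive biclique.  The vertices of
-- N(uv) in X are the x ≠ u adjacent to v; those in Y are the y ≠ v adjacent
-- to u.
SignedSimplicial : ∀ {m n} → SBigraph m n → Fin m × Fin n → Set
SignedSimplicial {m} {n} E (u , v) =
  IsEdge (E u v) ×
  ((x : Fin m) (y : Fin n) → x ≢ u → y ≢ v →
     IsEdge (E x v) → IsEdge (E u y) → E x y ≡ just pos)

EliminationOK : ∀ {m n} → SBigraph m n → List (Fin m × Fin n) → Set
EliminationOK E [] = ⊤
EliminationOK E (e ∷ es) = SignedSimplicial E e × EliminationOK (deleteEdge E e) es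

IsChordal : ∀ {m n} → SBigraph m n → Set
IsChordal {m} {n} E =
  Σ (List (Fin m × Fin n)) λ es →
    Unique es ×
    ((x : Fin m) (y : Fin n) → ((x , y) ∈ es → IsEdge (E x y)) × (IsEdge (E x y) → (x , y) ∈ es)) ×
    EliminationOK E es

-- The map need not respect the bipartitions (signed-graph isomorphism).
ContainsInduced : ∀ {a b m n} → SBigraph m n → SBigraph a b → Set
ContainsInduced {a} {b} {m} {n} G H =
  Σ (Vtx a b → Vtx m n) λ f →
    Injective _≡_ _≡_ f ×
    ((u v : Vtx a b) → adj G (f u) (f v) ≡ adj H u v)

F1 : SBigraph 2 2
F1 _ _ = just neg

-- F₂ : parts {a,b} = {0,1}, {p,q,r} = {0,1,2};
-- pa, aq, qb, br negative; bp = s₁, ar = s₂ arbitrary.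
F2 : Sign → Sign → SBigraph 2 3
F2 s₁ s₂ zero zero = just neg
F2 s₁ s₂ zero (suc zero) = just neg
F2 s₁ s₂ zero (suc (suc zero)) = just s₂
F2 s₁ s₂ (suc zero) zero = just s₁
F2 s₁ s₂ (suc zero) (suc zero) = just neg
F2 s₁ s₂ (suc zero) (suc (suc zero)) = just neg

-- F₃ : parts {a,b}, {p,q,r,s}; ap, aq, br, bs negative;
-- bp = t₁, bq = t₂, ar = t₃, as = t₄ arbitrary.
F3 : Sign → Sign → Sign → Sign → SBigraph 2 4
F3 t₁ t₂ t₃ t₄ zero zero = just neg
F3 t₁ t₂ t₃ t₄ zero (suc zero) = just neg
F3 t₁ t₂ t₃ t₄ zero (suc (suc zero)) = just t₃
F3 t₁ t₂ t₃ t₄ zero (suc (suc (suc zero))) = just t₄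
F3 t₁ t₂ t₃ t₄ (suc zero) zero = just t₁
F3 t₁ t₂ t₃ t₄ (suc zero) (suc zero) = just t₂
F3 t₁ t₂ t₃ t₄ (suc zero) (suc (suc zero)) = just neg
F3 t₁ t₂ t₃ t₄ (suc zero) (suc (suc (suc zero))) = just neg

-- F₄ : K_{3,3}, parts {a,b,c} = {0,1,2}, {p,q,r} = {0,1,2};
-- ap, bq, cr (the "diagonal") negative, other six edges given by τ.
F4 : (Fin 3 → Fin 3 → Sign) → SBigraph 3 3
F4 τ i j with i ≟ j
... | yes _ = just neg
... | no _  = just (τ i j)

ContainsForbidden : ∀ {m n} → SBigraph m n → Set
ContainsForbidden G =
  ContainsInduced G F1 ⊎
  (∃ λ s₁ → ∃ λ s₂ → ContainsInduced G (F2 s₁ s₂)) ⊎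
  (∃ λ t₁ → ∃ λ t₂ → ∃ λ t₃ → ∃ λ t₄ → ContainsInduced G (F3 t₁ t₂ t₃ t₄)) ⊎
  (∃ λ τ → ContainsInduced G (F4 τ))

-- A complete signed bigraph is chordal as soon as, for some u ∈ X and c ∈ Y, every edge
-- meeting neither u nor c is positive: eliminating the edges row by row, row u first and
-- column c first within each row, keeps each eliminated edge signed simplicial.  Otherwise
-- some negative edge x₁y₁ avoids (u₀ , c₀), a negative x₂y₂ avoids (x₁ , y₁), and negative
-- edges avoid (x₁ , y₂) and (x₂ , y₁); however these four overlap, they induce a member of
-- F₁ ∪ F₂ ∪ F₃ ∪ F₄.  Conversely, every forbidden graph is complete and each of its edges is
-- disjoint from a negative edge, so in any elimination ordering the first edge of an
-- induced copy cannot be signed simplicial.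
module Submission where

open import Defs
open import Data.Nat using (ℕ; zero; suc)
open import Data.Fin using (Fin; zero; suc; _≟_)
open import Data.Fin.Properties using (any?)
open import Data.Maybe using (just; nothing)
open import Data.Product using (∃; ∃₂; _×_; _,_; proj₁; proj₂)
open import Data.Product.Properties using (≡-dec)
open import Data.Sum using (_⊎_; inj₁; inj₂; swap)
open import Data.Sum.Properties using (inj₁-injective; inj₂-injective; swap-involutive)
open import Data.Unit using (⊤; tt)
open import Data.List using (List; []; _∷_; _++_; map; filter; allFin; cartesianProduct)
open import Data.List.Membership.Propositional using (_∈_; _∉_)
open import Data.List.Membership.Propositional.Properties
  using (∈-++⁻; ∈-++⁺ʳ; ∈-map⁻; ∈-filter⁺; ∈-allFin; ∈-cartesianProduct⁺; ∈-cartesianProduct⁻)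
open import Data.List.Relation.Unary.Any using (here; there)
open import Data.List.Relation.Unary.All as All using (All; []; _∷_)
open import Data.List.Relation.Unary.All.Properties using (all-filter; All¬⇒¬Any)
open import Data.List.Relation.Unary.AllPairs using ([]; _∷_)
open import Data.List.Relation.Unary.Unique.Propositional using (Unique)
open import Data.List.Relation.Unary.Unique.Propositional.Properties
  using (allFin⁺; filter⁺; cartesianProduct⁺)
open import Data.Vec using (Vec; lookup; []; _∷_)
open import Data.Vec.Relation.Unary.All using ([]; _∷_)
open import Data.Vec.Relation.Unary.AllPairs using ([]; _∷_)
import Data.Vec.Relation.Unary.Unique.Propositional as Vec
open import Data.Vec.Relation.Unary.Unique.Propositional.Properties using (lookup-injective)
open import Relation.Binary.PropositionalEquality
  using (_≡_; _≢_; refl; sym; trans; cong; cong₂; subst; ≢-sym)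
open import Relation.Nullary using (¬_; Dec; yes; no; ¬?; _×-dec_; contradiction)
open import Function using (_∘_; case_of_)
open import Function.Definitions using (Injective)

private variable
  a b m n : ℕ

transpose : SBigraph m n → SBigraph n m
transpose G y x = G x y

transpose-complete : {G : SBigraph m n} → IsComplete G → IsComplete (transpose G)
transpose-complete G-complete y x = G-complete x y

adj-transpose : (G : SBigraph m n) (u v : Vtx n m) →
                adj (transpose G) u v ≡ adj G (swap u) (swap v)
adj-transpose G (inj₁ _) (inj₁ _) = refl
adj-transpose G (inj₁ _) (inj₂ _) = refl
adj-transpose G (inj₂ _) (inj₁ _) = refl
adj-transpose G (inj₂ _) (inj₂ _) = refl

swap-injective : Injective _≡_ _≡_ (swap {A = Fin m} {B = Fin n})
swap-injective {x = u} {y = v} eq =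
  trans (sym (swap-involutive u)) (trans (cong swap eq) (swap-involutive v))

deleteEdge-self : (E : SBigraph m n) (x : Fin m) (y : Fin n) → deleteEdge E (x , y) x y ≡ nothing
deleteEdge-self E x y with x ≟ x | y ≟ y
... | yes _ | yes _ = refl
... | no x≢x | _ = contradiction refl x≢x
... | yes _ | no y≢y = contradiction refl y≢y

deleteEdge-other : (E : SBigraph m n) {x x' : Fin m} {y y' : Fin n} →
                   (x' , y') ≢ (x , y) → deleteEdge E (x , y) x' y' ≡ E x' y'
deleteEdge-other E {x} {x'} {y} {y'} ne with x' ≟ x | y' ≟ y
... | yes refl | yes refl = contradiction refl ne
... | yes _ | no _ = refl
... | no _ | _ = refl

-- Induced copies that respect the bipartition

record Embedding (G : SBigraph m n) (H : SBigraph a b) : Set where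
  constructor embedding
  field
    row : Fin a → Fin m
    col : Fin b → Fin n
    row-injective : Injective _≡_ _≡_ row
    col-injective : Injective _≡_ _≡_ col
    agrees : ∀ i j → G (row i) (col j) ≡ H i j

open Embedding using (row; col)

embedding⇒containsInduced : {G : SBigraph m n} {H : SBigraph a b} →
                            Embedding G H → ContainsInduced G H
embedding⇒containsInduced {G = G} {H} (embedding row col row-inj col-inj agrees) =
  f , f-injective , f-adj
  where
    f : Vtx _ _ → Vtx _ _
    f = Data.Sum.map row col

    f-injective : Injective _≡_ _≡_ f
    f-injective {inj₁ _} {inj₁ _} eq = cong inj₁ (row-inj (inj₁-injective eq))
    f-injective {inj₂ _} {inj₂ _} eq = cong inj₂ (col-inj (inj₂-injective eq))
    f-injective {inj₁ _} {inj₂ _} ()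
    f-injective {inj₂ _} {inj₁ _} ()

    f-adj : ∀ u v → adj G (f u) (f v) ≡ adj H u v
    f-adj (inj₁ i) (inj₂ j) = agrees i j
    f-adj (inj₂ j) (inj₁ i) = agrees i j
    f-adj (inj₁ _) (inj₁ _) = refl
    f-adj (inj₂ _) (inj₂ _) = refl

vecEmbedding : {G : SBigraph m n} {H : SBigraph a b}
               (rows : Vec (Fin m) a) (cols : Vec (Fin n) b) → Vec.Unique rows → Vec.Unique cols →
               (∀ i j → G (lookup rows i) (lookup cols j) ≡ H i j) → Embedding G H
vecEmbedding rows cols rows-unique cols-unique =
  embedding (lookup rows) (lookup cols)
            (lookup-injective rows-unique _ _) (lookup-injective cols-unique _ _)

containsInduced-transposeˡ : {G : SBigraph m n} {H : SBigraph a b} →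
                             ContainsInduced (transpose G) H → ContainsInduced G H
containsInduced-transposeˡ {G = G} (f , f-inj , f-adj) =
  swap ∘ f , f-inj ∘ swap-injective ,
  λ u v → trans (sym (adj-transpose G (f u) (f v))) (f-adj u v)

containsInduced-transposeʳ : {G : SBigraph m n} {H : SBigraph a b} →
                             ContainsInduced G H → ContainsInduced G (transpose H)
containsInduced-transposeʳ {H = H} (f , f-inj , f-adj) =
  f ∘ swap , swap-injective ∘ f-inj ,
  λ u v → trans (f-adj (swap u) (swap v)) (sym (adj-transpose H u v))

adjacent-inj₂⇒inj₁ : (G : SBigraph m n) (v : Vtx m n) {y : Fin n} →
                     IsEdge (adj G v (inj₂ y)) → ∃ λ x → v ≡ inj₁ x
adjacent-inj₂⇒inj₁ G (inj₁ x) _ = x , refl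
adjacent-inj₂⇒inj₁ G (inj₂ _) (_ , ())

adjacent-inj₁⇒inj₂ : (G : SBigraph m n) {x : Fin m} (v : Vtx m n) →
                     IsEdge (adj G (inj₁ x) v) → ∃ λ y → v ≡ inj₂ y
adjacent-inj₁⇒inj₂ G (inj₂ y) _ = y , refl
adjacent-inj₁⇒inj₂ G (inj₁ _) (_ , ())

aligned⇒embedding : {G : SBigraph m n} {H : SBigraph a b} → IsComplete H →
                    (copy : ContainsInduced G H) {i₀ : Fin a} {x₀ : Fin m} → Fin b →
                    proj₁ copy (inj₁ i₀) ≡ inj₁ x₀ → Embedding G H
aligned⇒embedding {G = G} {H} H-complete (f , f-inj , f-adj) {i₀} j₀ fi₀≡x₀ =
  embedding (proj₁ ∘ rowOf) (proj₁ ∘ colOf) row-injective col-injective agrees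
  where
    edge : ∀ i j → IsEdge (adj G (f (inj₁ i)) (f (inj₂ j)))
    edge i j = subst IsEdge (sym (f-adj (inj₁ i) (inj₂ j))) (H-complete i j)

    colOf : ∀ j → ∃ λ y → f (inj₂ j) ≡ inj₂ y
    colOf j = adjacent-inj₁⇒inj₂ G (f (inj₂ j))
                (subst (λ v → IsEdge (adj G v (f (inj₂ j)))) fi₀≡x₀ (edge i₀ j))

    rowOf : ∀ i → ∃ λ x → f (inj₁ i) ≡ inj₁ x
    rowOf i = adjacent-inj₂⇒inj₁ G (f (inj₁ i))
                (subst (λ w → IsEdge (adj G (f (inj₁ i)) w)) (proj₂ (colOf j₀)) (edge i j₀))

    row-injective : Injective _≡_ _≡_ (proj₁ ∘ rowOf)
    row-injective {i} {i'} eq =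
      inj₁-injective (f-inj (trans (proj₂ (rowOf i)) (trans (cong inj₁ eq) (sym (proj₂ (rowOf i'))))))

    col-injective : Injective _≡_ _≡_ (proj₁ ∘ colOf)
    col-injective {j} {j'} eq =
      inj₂-injective (f-inj (trans (proj₂ (colOf j)) (trans (cong inj₂ eq) (sym (proj₂ (colOf j'))))))

    agrees : ∀ i j → G (proj₁ (rowOf i)) (proj₁ (colOf j)) ≡ H i j
    agrees i j =
      trans (cong₂ (adj G) (sym (proj₂ (rowOf i))) (sym (proj₂ (colOf j)))) (f-adj (inj₁ i) (inj₂ j))

containsInduced⇒embedding : {G : SBigraph m n} {H : SBigraph a b} → IsComplete H → Fin a → Fin b →
                            ContainsInduced G H → Embedding G H ⊎ Embedding G (transpose H)
containsInduced⇒embedding {G = G} H-complete i₀ j₀ copy@(f , _ , f-adj) with f (inj₁ i₀) in fi₀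
... | inj₁ _ = inj₁ (aligned⇒embedding H-complete copy j₀ fi₀)
... | inj₂ _ =
  inj₂ (aligned⇒embedding (transpose-complete H-complete) (containsInduced-transposeʳ copy) i₀
          (proj₂ (adjacent-inj₂⇒inj₁ G (f (inj₂ j₀))
            (subst (λ w → IsEdge (adj G (f (inj₂ j₀)) w)) fi₀
              (subst IsEdge (sym (f-adj (inj₂ j₀) (inj₁ i₀))) (H-complete i₀ j₀))))))

-- Chordal complete bigraphs contain no forbidden graph

-- For complete H, disjointNegative says that no edge of H is signed simplicial;
-- row₀ and col₀ rule out an empty side, where there would be no edge to obstruct.
record Obstruction (H : SBigraph a b) : Set where
  field
    complete : IsComplete H
    disjointNegative : ∀ i j → ∃₂ λ i' j' → i' ≢ i × j' ≢ j × H i' j' ≡ just neg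
    row₀ : Fin a
    col₀ : Fin b

obstruction-transpose : {H : SBigraph a b} → Obstruction H → Obstruction (transpose H)
obstruction-transpose obstruction = record
  { complete = transpose-complete complete
  ; disjointNegative = λ j i → case disjointNegative i j of λ where
      (i' , j' , i'≢i , j'≢j , negative) → j' , i' , j'≢j , i'≢i , negative
  ; row₀ = col₀
  ; col₀ = row₀
  }
  where open Obstruction obstruction

embedding-deleteEdge : {K : SBigraph m n} {H : SBigraph a b} {e : Fin m × Fin n} →
                       (emb : Embedding K H) → (∀ i j → (row emb i , col emb j) ≢ e) →
                       Embedding (deleteEdge K e) H
embedding-deleteEdge {K = K} (embedding row col row-inj col-inj agrees) outside =
  embedding row col row-inj col-inj λ i j → trans (deleteEdge-other K (outside i j)) (agrees i j)

image-¬signedSimplicial : {K : SBigraph m n} {H : SBigraph a b} → Obstruction H →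
                          (emb : Embedding K H) → ∀ i j →
                          ¬ SignedSimplicial K (row emb i , col emb j)
image-¬signedSimplicial {K = K} obstruction (embedding row col row-inj col-inj agrees) i j (_ , biclique)
  with Obstruction.disjointNegative obstruction i j
... | i' , j' , i'≢i , j'≢j , negative =
  case trans (sym positive) (trans (agrees i' j') negative) of λ ()
  where
    edge : ∀ i j → IsEdge (K (row i) (col j))
    edge i j = subst IsEdge (sym (agrees i j)) (Obstruction.complete obstruction i j)

    positive : K (row i') (col j') ≡ just pos
    positive = biclique (row i') (col j') (i'≢i ∘ row-inj) (j'≢j ∘ col-inj) (edge i' j) (edge i j')

-- The first edge of the copy to be eliminated would have to be signed simplicial.
obstruction-¬eliminationOK : {K : SBigraph m n} {H : SBigraph a b} → Obstruction H →
                             (emb : Embedding K H) (L : List (Fin m × Fin n)) →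
                             (∀ i j → (row emb i , col emb j) ∈ L) →
                             ¬ EliminationOK K L
obstruction-¬eliminationOK obstruction emb [] covered _ =
  case covered (Obstruction.row₀ obstruction) (Obstruction.col₀ obstruction) of λ ()
obstruction-¬eliminationOK obstruction emb (e ∷ L) covered (simplicial , ok)
  with any? (λ i → any? (λ j → ≡-dec _≟_ _≟_ (row emb i , col emb j) e))
... | yes (i , j , refl) = image-¬signedSimplicial obstruction emb i j simplicial
... | no e∉image =
  obstruction-¬eliminationOK obstruction (embedding-deleteEdge emb outside) L covered' ok
  where
    outside : ∀ i j → (row emb i , col emb j) ≢ e
    outside i j eq = e∉image (i , j , eq)

    covered' : ∀ i j → (row emb i , col emb j) ∈ L
    covered' i j with covered i j
    ... | here eq = contradiction eq (outside i j)
    ... | there p = p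

chordal⇒¬containsObstruction : {G : SBigraph m n} {H : SBigraph a b} → IsComplete G → IsChordal G →
                               Obstruction H → ¬ ContainsInduced G H
chordal⇒¬containsObstruction {G = G} G-complete (L , _ , edges , ok) obstruction copy =
  case containsInduced⇒embedding complete row₀ col₀ copy of λ where
    (inj₁ emb) → obstruction-¬eliminationOK obstruction emb L (covered emb) ok
    (inj₂ emb) → obstruction-¬eliminationOK (obstruction-transpose obstruction) emb L (covered emb) ok
  where
    open Obstruction obstruction
    covered : ∀ {a b} {H' : SBigraph a b} (emb : Embedding G H') →
              ∀ i j → (row emb i , col emb j) ∈ L
    covered _ i j = proj₂ (edges _ _) (G-complete _ _)

F1-obstruction : Obstruction F1
F1-obstruction = record
  { complete = λ _ _ → neg , refl
  ; disjointNegative = λ where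
      zero zero → suc zero , suc zero , (λ ()) , (λ ()) , refl
      zero (suc zero) → suc zero , zero , (λ ()) , (λ ()) , refl
      (suc zero) zero → zero , suc zero , (λ ()) , (λ ()) , refl
      (suc zero) (suc zero) → zero , zero , (λ ()) , (λ ()) , refl
  ; row₀ = zero
  ; col₀ = zero
  }

F2-obstruction : ∀ s₁ s₂ → Obstruction (F2 s₁ s₂)
F2-obstruction s₁ s₂ = record
  { complete = λ where
      zero zero → _ , refl
      zero (suc zero) → _ , refl
      zero (suc (suc zero)) → _ , refl
      (suc zero) zero → _ , refl
      (suc zero) (suc zero) → _ , refl
      (suc zero) (suc (suc zero)) → _ , refl
  ; disjointNegative = λ where
      zero zero → suc zero , suc zero , (λ ()) , (λ ()) , refl
      zero (suc zero) → suc zero , suc (suc zero) , (λ ()) , (λ ()) , refl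
      zero (suc (suc zero)) → suc zero , suc zero , (λ ()) , (λ ()) , refl
      (suc zero) zero → zero , suc zero , (λ ()) , (λ ()) , refl
      (suc zero) (suc zero) → zero , zero , (λ ()) , (λ ()) , refl
      (suc zero) (suc (suc zero)) → zero , zero , (λ ()) , (λ ()) , refl
  ; row₀ = zero
  ; col₀ = zero
  }

F3-obstruction : ∀ t₁ t₂ t₃ t₄ → Obstruction (F3 t₁ t₂ t₃ t₄)
F3-obstruction t₁ t₂ t₃ t₄ = record
  { complete = λ where
      zero zero → _ , refl
      zero (suc zero) → _ , refl
      zero (suc (suc zero)) → _ , refl
      zero (suc (suc (suc zero))) → _ , refl
      (suc zero) zero → _ , refl
      (suc zero) (suc zero) → _ , refl
      (suc zero) (suc (suc zero)) → _ , refl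
      (suc zero) (suc (suc (suc zero))) → _ , refl
  ; disjointNegative = λ where
      zero zero → suc zero , suc (suc zero) , (λ ()) , (λ ()) , refl
      zero (suc zero) → suc zero , suc (suc zero) , (λ ()) , (λ ()) , refl
      zero (suc (suc zero)) → suc zero , suc (suc (suc zero)) , (λ ()) , (λ ()) , refl
      zero (suc (suc (suc zero))) → suc zero , suc (suc zero) , (λ ()) , (λ ()) , refl
      (suc zero) zero → zero , suc zero , (λ ()) , (λ ()) , refl
      (suc zero) (suc zero) → zero , zero , (λ ()) , (λ ()) , refl
      (suc zero) (suc (suc zero)) → zero , zero , (λ ()) , (λ ()) , refl
      (suc zero) (suc (suc (suc zero))) → zero , zero , (λ ()) , (λ ()) , refl
  ; row₀ = zero
  ; col₀ = zero
  }

F4-obstruction : ∀ τ → Obstruction (F4 τ)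
F4-obstruction τ = record
  { complete = complete
  ; disjointNegative = λ i j → case other i j of λ where
      (k , k≢i , k≢j) → k , k , k≢i , k≢j , diagonal k
  ; row₀ = zero
  ; col₀ = zero
  }
  where
    complete : IsComplete (F4 τ)
    complete i j with i ≟ j
    ... | yes _ = neg , refl
    ... | no _ = τ i j , refl

    diagonal : ∀ k → F4 τ k k ≡ just neg
    diagonal k with k ≟ k
    ... | yes _ = refl
    ... | no k≢k = contradiction refl k≢k

    other : (i j : Fin 3) → ∃ λ k → k ≢ i × k ≢ j
    other zero zero = suc zero , (λ ()) , (λ ())
    other zero (suc zero) = suc (suc zero) , (λ ()) , (λ ())
    other zero (suc (suc zero)) = suc zero , (λ ()) , (λ ())
    other (suc zero) zero = suc (suc zero) , (λ ()) , (λ ())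
    other (suc zero) (suc zero) = zero , (λ ()) , (λ ())
    other (suc zero) (suc (suc zero)) = zero , (λ ()) , (λ ())
    other (suc (suc zero)) zero = suc zero , (λ ()) , (λ ())
    other (suc (suc zero)) (suc zero) = zero , (λ ()) , (λ ())
    other (suc (suc zero)) (suc (suc zero)) = zero , (λ ()) , (λ ())

chordal⇒¬containsForbidden : {G : SBigraph m n} → IsComplete G → IsChordal G → ¬ ContainsForbidden G
chordal⇒¬containsForbidden G-complete chordal (inj₁ copy) =
  chordal⇒¬containsObstruction G-complete chordal F1-obstruction copy
chordal⇒¬containsForbidden G-complete chordal (inj₂ (inj₁ (s₁ , s₂ , copy))) =
  chordal⇒¬containsObstruction G-complete chordal (F2-obstruction s₁ s₂) copy
chordal⇒¬containsForbidden G-complete chordal (inj₂ (inj₂ (inj₁ (t₁ , t₂ , t₃ , t₄ , copy)))) =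
  chordal⇒¬containsObstruction G-complete chordal (F3-obstruction t₁ t₂ t₃ t₄) copy
chordal⇒¬containsForbidden G-complete chordal (inj₂ (inj₂ (inj₂ (τ , copy)))) =
  chordal⇒¬containsObstruction G-complete chordal (F4-obstruction τ) copy

-- Elimination orderings

module _ (G : SBigraph m n) where

  IsRestriction : List (Fin m × Fin n) → SBigraph m n → Set
  IsRestriction L K = ∀ x y → (IsEdge (K x y) → (x , y) ∈ L) × ((x , y) ∈ L → K x y ≡ G x y)

  SimplicialAmong : List (Fin m × Fin n) → Fin m × Fin n → Set
  SimplicialAmong rest (x , y) =
    ∀ x' y' → x' ≢ x → y' ≢ y → (x' , y) ∈ rest → (x , y') ∈ rest →
    (x' , y') ∈ rest × G x' y' ≡ just pos

  SimplicialOrdering : List (Fin m × Fin n) → Set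
  SimplicialOrdering [] = ⊤
  SimplicialOrdering (e ∷ rest) = SimplicialAmong rest e × SimplicialOrdering rest

  PositiveAwayFrom : Fin m → Fin n → Set
  PositiveAwayFrom u c = ∀ x y → x ≢ u → y ≢ c → G x y ≡ just pos

simplicialOrdering⇒eliminationOK : {G K : SBigraph m n} {L : List (Fin m × Fin n)} → IsComplete G →
                                   Unique L → IsRestriction G L K → SimplicialOrdering G L →
                                   EliminationOK K L
simplicialOrdering⇒eliminationOK {L = []} _ _ _ _ = tt
simplicialOrdering⇒eliminationOK {G = G} {K} {L = (x , y) ∷ rest} G-complete
                                 (fresh ∷ unique) restriction (among , ordering) =
  simplicial ,
  simplicialOrdering⇒eliminationOK G-complete unique restriction′ ordering
  where
    K≡G : ∀ {x' y'} → (x' , y') ∈ (x , y) ∷ rest → K x' y' ≡ G x' y'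
    K≡G = proj₂ (restriction _ _)

    ∈rest : ∀ {x' y'} → (x' , y') ≢ (x , y) → IsEdge (K x' y') → (x' , y') ∈ rest
    ∈rest ne edge with proj₁ (restriction _ _) edge
    ... | here eq = contradiction eq ne
    ... | there p = p

    simplicial : SignedSimplicial K (x , y)
    simplicial = subst IsEdge (sym (K≡G (here refl))) (G-complete x y) , λ x' y' x'≢x y'≢y e₁ e₂ →
      case among x' y' x'≢x y'≢y (∈rest (x'≢x ∘ cong proj₁) e₁) (∈rest (y'≢y ∘ cong proj₂) e₂) of λ where
        (p , positive) → trans (K≡G (there p)) positive

    restriction′ : IsRestriction G rest (deleteEdge K (x , y))
    restriction′ x' y' with ≡-dec _≟_ _≟_ (x' , y') (x , y)
    ... | yes refl = (λ edge → case trans (sym (proj₂ edge)) (deleteEdge-self K x y) of λ ()) ,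
                     (λ p → contradiction refl (All.lookup fresh p))
    ... | no ne = (λ edge → ∈rest ne (subst IsEdge (deleteEdge-other K ne) edge)) ,
                  (λ p → trans (deleteEdge-other K ne) (K≡G (there p)))

allBut : ∀ {k} → Fin k → List (Fin k)
allBut v = filter (λ w → ¬? (w ≟ v)) (allFin _)

allBut-avoids : ∀ {k} (v : Fin k) → All (_≢ v) (allBut v)
allBut-avoids v = all-filter (λ w → ¬? (w ≟ v)) (allFin _)

∈-∷allBut : ∀ {k} (v w : Fin k) → w ∈ v ∷ allBut v
∈-∷allBut v w with w ≟ v
... | yes refl = here refl
... | no w≢v = there (∈-filter⁺ (λ w → ¬? (w ≟ v)) (∈-allFin w) w≢v)

∷allBut-unique : ∀ {k} (v : Fin k) → Unique (v ∷ allBut v)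
∷allBut-unique v =
  All.map ≢-sym (allBut-avoids v) ∷ filter⁺ (λ w → ¬? (w ≟ v)) (allFin⁺ _)

module LexicographicOrdering {G : SBigraph m n} {u : Fin m} {c : Fin n}
                             (positive : PositiveAwayFrom G u c) where

  cols : List (Fin n)
  cols = c ∷ allBut c

  simplicialAmong-row : ∀ {x y rows ds} → x ∉ rows → All (_≢ u) rows → All (_≢ c) ds →
                        SimplicialAmong G (map (x ,_) ds ++ cartesianProduct rows cols) (x , y)
  simplicialAmong-row {x} {rows = rows} {ds} x∉rows rows-avoid ds-avoid x' y' x'≢x _ x'y∈ xy'∈
    with ∈-++⁻ (map (x ,_) ds) x'y∈ | ∈-++⁻ (map (x ,_) ds) xy'∈
  ... | inj₁ x'y∈row | _ = case ∈-map⁻ (x ,_) x'y∈row of λ where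
    (_ , _ , eq) → contradiction (cong proj₁ eq) x'≢x
  ... | inj₂ _ | inj₂ xy'∈later = contradiction (proj₁ (∈-cartesianProduct⁻ rows cols xy'∈later)) x∉rows
  ... | inj₂ x'y∈later | inj₁ xy'∈row with ∈-map⁻ (x ,_) xy'∈row
  ...   | _ , y'∈ds , refl =
    ∈-++⁺ʳ (map (x ,_) ds) (∈-cartesianProduct⁺ x'∈rows (∈-∷allBut c y')) ,
    positive x' y' (All.lookup rows-avoid x'∈rows) (All.lookup ds-avoid y'∈ds)
    where
      x'∈rows : x' ∈ rows
      x'∈rows = proj₁ (∈-cartesianProduct⁻ rows cols x'y∈later)

  rowOrdering : ∀ {x rows} y ds → All (_≢ c) ds → x ∉ rows → All (_≢ u) rows →
                SimplicialOrdering G (cartesianProduct rows cols) →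
                SimplicialOrdering G (map (x ,_) (y ∷ ds) ++ cartesianProduct rows cols)
  rowOrdering y [] [] x∉rows rows-avoid later =
    simplicialAmong-row x∉rows rows-avoid [] , later
  rowOrdering y (d ∷ ds) ds-avoid@(_ ∷ ds-avoid′) x∉rows rows-avoid later =
    simplicialAmong-row x∉rows rows-avoid ds-avoid ,
    rowOrdering d ds ds-avoid′ x∉rows rows-avoid later

  rowsOrdering : ∀ rows → Unique rows → All (_≢ u) rows →
                 SimplicialOrdering G (cartesianProduct rows cols)
  rowsOrdering [] _ _ = tt
  rowsOrdering (x ∷ rows) (fresh ∷ unique) (_ ∷ rows-avoid) =
    rowOrdering c (allBut c) (allBut-avoids c) (All¬⇒¬Any fresh) rows-avoid
                (rowsOrdering rows unique rows-avoid)

  lexOrdering : SimplicialOrdering G (cartesianProduct (u ∷ allBut u) cols)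
  lexOrdering =
    rowOrdering c (allBut c) (allBut-avoids c) (λ u∈ → All.lookup (allBut-avoids u) u∈ refl)
                (allBut-avoids u) (rowsOrdering (allBut u) (filter⁺ _ (allFin⁺ _)) (allBut-avoids u))

positiveAwayFrom⇒chordal : {G : SBigraph m n} {u : Fin m} {c : Fin n} → IsComplete G →
                           PositiveAwayFrom G u c → IsChordal G
positiveAwayFrom⇒chordal {G = G} {u} {c} G-complete positive =
  L , unique , (λ x y → (λ _ → G-complete x y) , (λ _ → ∈L x y)) ,
  simplicialOrdering⇒eliminationOK G-complete unique (λ x y → (λ _ → ∈L x y) , (λ _ → refl))
    (LexicographicOrdering.lexOrdering positive)
  where
    L : List (Fin _ × Fin _)
    L = cartesianProduct (u ∷ allBut u) (c ∷ allBut c)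

    unique : Unique L
    unique = cartesianProduct⁺ (∷allBut-unique u) (∷allBut-unique c)

    ∈L : ∀ x y → (x , y) ∈ L
    ∈L x y = ∈-cartesianProduct⁺ (∈-∷allBut u x) (∈-∷allBut c y)

-- Finding a forbidden induced subgraph

containsForbidden-transpose : {G : SBigraph m n} → ContainsForbidden (transpose G) → ContainsForbidden G
containsForbidden-transpose (inj₁ copy) = inj₁ (containsInduced-transposeˡ copy)
containsForbidden-transpose (inj₂ (inj₁ (s₁ , s₂ , copy))) =
  inj₂ (inj₁ (s₁ , s₂ , containsInduced-transposeˡ copy))
containsForbidden-transpose (inj₂ (inj₂ (inj₁ (t₁ , t₂ , t₃ , t₄ , copy)))) =
  inj₂ (inj₂ (inj₁ (t₁ , t₂ , t₃ , t₄ , containsInduced-transposeˡ copy)))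
containsForbidden-transpose (inj₂ (inj₂ (inj₂ (τ , copy)))) =
  inj₂ (inj₂ (inj₂ (τ , containsInduced-transposeˡ copy)))

distinct₂ : {A : Set} {a b : A} → b ≢ a → Vec.Unique (a ∷ b ∷ [])
distinct₂ b≢a = (≢-sym b≢a ∷ []) ∷ [] ∷ []

distinct₃ : {A : Set} {a b c : A} → b ≢ a → c ≢ a → c ≢ b → Vec.Unique (a ∷ b ∷ c ∷ [])
distinct₃ b≢a c≢a c≢b = (≢-sym b≢a ∷ ≢-sym c≢a ∷ []) ∷ distinct₂ c≢b

distinct₄ : {A : Set} {a b c d : A} → b ≢ a → c ≢ a → d ≢ a → c ≢ b → d ≢ b → d ≢ c →
            Vec.Unique (a ∷ b ∷ c ∷ d ∷ [])
distinct₄ b≢a c≢a d≢a c≢b d≢b d≢c =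
  (≢-sym b≢a ∷ ≢-sym c≢a ∷ ≢-sym d≢a ∷ []) ∷ distinct₃ c≢b d≢b d≢c

module ForbiddenCopies {G : SBigraph m n} (G-complete : IsComplete G) where

  Negative : Fin m → Fin n → Set
  Negative x y = G x y ≡ just neg

  sign : Fin m → Fin n → Sign
  sign x y = proj₁ (G-complete x y)

  signed : ∀ x y → G x y ≡ just (sign x y)
  signed x y = proj₂ (G-complete x y)

  containsF1 : ∀ {a b p q} → b ≢ a → q ≢ p →
               Negative a p → Negative a q → Negative b p → Negative b q → ContainsForbidden G
  containsF1 {a} {b} {p} {q} b≢a q≢p ap aq bp bq =
    inj₁ (embedding⇒containsInduced
      (vecEmbedding (a ∷ b ∷ []) (p ∷ q ∷ []) (distinct₂ b≢a) (distinct₂ q≢p) agrees))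
    where
      agrees : ∀ i j → G (lookup (a ∷ b ∷ []) i) (lookup (p ∷ q ∷ []) j) ≡ F1 i j
      agrees zero zero = ap
      agrees zero (suc zero) = aq
      agrees (suc zero) zero = bp
      agrees (suc zero) (suc zero) = bq

  containsF2 : ∀ {a b p q r} → b ≢ a → q ≢ p → r ≢ p → r ≢ q →
               Negative a p → Negative a q → Negative b q → Negative b r → ContainsForbidden G
  containsF2 {a} {b} {p} {q} {r} b≢a q≢p r≢p r≢q ap aq bq br =
    inj₂ (inj₁ (sign b p , sign a r , embedding⇒containsInduced
      (vecEmbedding (a ∷ b ∷ []) (p ∷ q ∷ r ∷ []) (distinct₂ b≢a) (distinct₃ q≢p r≢p r≢q) agrees)))
    where
      agrees : ∀ i j → G (lookup (a ∷ b ∷ []) i) (lookup (p ∷ q ∷ r ∷ []) j) ≡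
                       F2 (sign b p) (sign a r) i j
      agrees zero zero = ap
      agrees zero (suc zero) = aq
      agrees zero (suc (suc zero)) = signed a r
      agrees (suc zero) zero = signed b p
      agrees (suc zero) (suc zero) = bq
      agrees (suc zero) (suc (suc zero)) = br

  containsF3 : ∀ {a b p q r s} → b ≢ a → q ≢ p → r ≢ p → s ≢ p → r ≢ q → s ≢ q → s ≢ r →
               Negative a p → Negative a q → Negative b r → Negative b s → ContainsForbidden G
  containsF3 {a} {b} {p} {q} {r} {s} b≢a q≢p r≢p s≢p r≢q s≢q s≢r ap aq br bs =
    inj₂ (inj₂ (inj₁ (sign b p , sign b q , sign a r , sign a s , embedding⇒containsInduced
      (vecEmbedding (a ∷ b ∷ []) (p ∷ q ∷ r ∷ s ∷ [])
        (distinct₂ b≢a) (distinct₄ q≢p r≢p s≢p r≢q s≢q s≢r) agrees))))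
    where
      agrees : ∀ i j → G (lookup (a ∷ b ∷ []) i) (lookup (p ∷ q ∷ r ∷ s ∷ []) j) ≡
                       F3 (sign b p) (sign b q) (sign a r) (sign a s) i j
      agrees zero zero = ap
      agrees zero (suc zero) = aq
      agrees zero (suc (suc zero)) = signed a r
      agrees zero (suc (suc (suc zero))) = signed a s
      agrees (suc zero) zero = signed b p
      agrees (suc zero) (suc zero) = signed b q
      agrees (suc zero) (suc (suc zero)) = br
      agrees (suc zero) (suc (suc (suc zero))) = bs

  containsF2-or-F3 : ∀ {a b p q r s} → b ≢ a → q ≢ p → r ≢ p → s ≢ p → r ≢ q → s ≢ r →
                     Negative a p → Negative a q → Negative b r → Negative b s → ContainsForbidden G
  containsF2-or-F3 {q = q} {s = s} b≢a q≢p r≢p s≢p r≢q s≢r ap aq br bs with s ≟ q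
  ... | yes refl = containsF2 b≢a q≢p r≢p r≢q ap aq bs br
  ... | no s≢q = containsF3 b≢a q≢p r≢p s≢p r≢q s≢q s≢r ap aq br bs

  containsF4 : ∀ {a b c p q r} → b ≢ a → c ≢ a → c ≢ b → q ≢ p → r ≢ p → r ≢ q →
               Negative a p → Negative b q → Negative c r → ContainsForbidden G
  containsF4 {a} {b} {c} {p} {q} {r} b≢a c≢a c≢b q≢p r≢p r≢q ap bq cr =
    inj₂ (inj₂ (inj₂ (τ , embedding⇒containsInduced
      (vecEmbedding rows cols (distinct₃ b≢a c≢a c≢b) (distinct₃ q≢p r≢p r≢q) agrees))))
    where
      rows : Vec (Fin m) 3
      rows = a ∷ b ∷ c ∷ []

      cols : Vec (Fin n) 3
      cols = p ∷ q ∷ r ∷ []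

      τ : Fin 3 → Fin 3 → Sign
      τ i j = sign (lookup rows i) (lookup cols j)

      diagonal : ∀ k → Negative (lookup rows k) (lookup cols k)
      diagonal zero = ap
      diagonal (suc zero) = bq
      diagonal (suc (suc zero)) = cr

      agrees : ∀ i j → G (lookup rows i) (lookup cols j) ≡ F4 τ i j
      agrees i j with i ≟ j
      ... | yes refl = diagonal i
      ... | no _ = signed _ _

isNeg? : (s : Sign) → Dec (s ≡ neg)
isNeg? pos = no λ ()
isNeg? neg = yes refl

¬neg⇒pos : {s : Sign} → s ≢ neg → s ≡ pos
¬neg⇒pos {pos} _ = refl
¬neg⇒pos {neg} s≢neg = contradiction refl s≢neg

module _ {G : SBigraph m n} (G-complete : IsComplete G) where
  open ForbiddenCopies G-complete
  module ᵀ = ForbiddenCopies (transpose-complete G-complete)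

  negativeQuadruple⇒containsForbidden :
    ∀ {x₁ x₂ x₃ x₄ y₁ y₂ y₃ y₄} → x₂ ≢ x₁ → y₂ ≢ y₁ → x₃ ≢ x₁ → y₃ ≢ y₂ → x₄ ≢ x₂ → y₄ ≢ y₁ →
    Negative x₁ y₁ → Negative x₂ y₂ → Negative x₃ y₃ → Negative x₄ y₄ → ContainsForbidden G
  negativeQuadruple⇒containsForbidden {x₁} {x₂} {x₃} {x₄} {y₁} {y₂} {y₃} {y₄}
                                      x₂≢x₁ y₂≢y₁ x₃≢x₁ y₃≢y₂ x₄≢x₂ y₄≢y₁ n₁ n₂ n₃ n₄
    with x₃ ≟ x₂ | y₃ ≟ y₁ | x₄ ≟ x₁ | y₄ ≟ y₂
  ... | no x₃≢x₂ | no y₃≢y₁ | _ | _ = containsF4 x₂≢x₁ x₃≢x₁ x₃≢x₂ y₂≢y₁ y₃≢y₁ y₃≢y₂ n₁ n₂ n₃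
  ... | _ | _ | no x₄≢x₁ | no y₄≢y₂ = containsF4 x₂≢x₁ x₄≢x₁ x₄≢x₂ y₂≢y₁ y₄≢y₁ y₄≢y₂ n₁ n₂ n₄
  ... | yes refl | yes refl | yes refl | yes refl = containsF1 x₂≢x₁ y₂≢y₁ n₁ n₄ n₃ n₂
  ... | yes refl | yes refl | yes refl | no y₄≢y₂ =
    containsF2 x₂≢x₁ (≢-sym y₄≢y₁) (≢-sym y₄≢y₂) y₂≢y₁ n₄ n₁ n₃ n₂
  ... | yes refl | yes refl | no x₄≢x₁ | yes refl =
    containsForbidden-transpose (ᵀ.containsF2 y₂≢y₁ x₂≢x₁ x₄≢x₁ x₄≢x₂ n₁ n₃ n₂ n₄)
  ... | yes refl | no y₃≢y₁ | yes refl | yes refl = containsF2 x₂≢x₁ y₂≢y₁ y₃≢y₁ y₃≢y₂ n₁ n₄ n₂ n₃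
  ... | yes refl | no y₃≢y₁ | yes refl | no y₄≢y₂ =
    containsF2-or-F3 x₂≢x₁ y₄≢y₁ y₂≢y₁ y₃≢y₁ (≢-sym y₄≢y₂) y₃≢y₂ n₁ n₄ n₂ n₃
  ... | yes refl | no y₃≢y₁ | no x₄≢x₁ | yes refl =
    containsF4 x₄≢x₁ x₂≢x₁ (≢-sym x₄≢x₂) y₂≢y₁ y₃≢y₁ y₃≢y₂ n₁ n₄ n₃
  ... | no x₃≢x₂ | yes refl | yes refl | yes refl =
    containsForbidden-transpose (ᵀ.containsF2 y₂≢y₁ (≢-sym x₃≢x₁) (≢-sym x₃≢x₂) x₂≢x₁ n₃ n₁ n₄ n₂)
  ... | no x₃≢x₂ | yes refl | yes refl | no y₄≢y₂ =
    containsF4 (≢-sym x₃≢x₁) (≢-sym x₃≢x₂) x₂≢x₁ y₄≢y₁ y₂≢y₁ (≢-sym y₄≢y₂) n₃ n₄ n₂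
  ... | no x₃≢x₂ | yes refl | no x₄≢x₁ | yes refl =
    containsForbidden-transpose
      (ᵀ.containsF2-or-F3 y₂≢y₁ x₃≢x₁ x₂≢x₁ x₄≢x₁ (≢-sym x₃≢x₂) x₄≢x₂ n₁ n₃ n₂ n₄)

  positiveAwayFrom-or-negative : ∀ u c → PositiveAwayFrom G u c ⊎ ∃₂ λ x y → x ≢ u × y ≢ c × Negative x y
  positiveAwayFrom-or-negative u c
    with any? (λ x → any? (λ y → ¬? (x ≟ u) ×-dec ¬? (y ≟ c) ×-dec isNeg? (sign x y)))
  ... | yes (x , y , x≢u , y≢c , negative) =
    inj₂ (x , y , x≢u , y≢c , trans (signed x y) (cong just negative))
  ... | no none = inj₁ λ x y x≢u y≢c →
    trans (signed x y) (cong just (¬neg⇒pos λ negative → none (x , y , x≢u , y≢c , negative)))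

  positiveAwayFrom-or-containsForbidden : Fin m → Fin n →
                                          (∃₂ λ u c → PositiveAwayFrom G u c) ⊎ ContainsForbidden G
  positiveAwayFrom-or-containsForbidden u₀ c₀ with positiveAwayFrom-or-negative u₀ c₀
  ... | inj₁ positive = inj₁ (u₀ , c₀ , positive)
  ... | inj₂ (x₁ , y₁ , _ , _ , n₁) with positiveAwayFrom-or-negative x₁ y₁
  ...   | inj₁ positive = inj₁ (x₁ , y₁ , positive)
  ...   | inj₂ (x₂ , y₂ , x₂≢x₁ , y₂≢y₁ , n₂)
          with positiveAwayFrom-or-negative x₁ y₂ | positiveAwayFrom-or-negative x₂ y₁
  ...     | inj₁ positive | _ = inj₁ (x₁ , y₂ , positive)
  ...     | inj₂ _ | inj₁ positive = inj₁ (x₂ , y₁ , positive)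
  ...     | inj₂ (_ , _ , x₃≢x₁ , y₃≢y₂ , n₃) | inj₂ (_ , _ , x₄≢x₂ , y₄≢y₁ , n₄) =
    inj₂ (negativeQuadruple⇒containsForbidden x₂≢x₁ y₂≢y₁ x₃≢x₁ y₃≢y₂ x₄≢x₂ y₄≢y₁ n₁ n₂ n₃ n₄)

¬containsForbidden⇒chordal : {G : SBigraph m n} → IsComplete G → ¬ ContainsForbidden G → IsChordal G
¬containsForbidden⇒chordal {zero} _ _ = [] , [] , (λ ()) , tt
¬containsForbidden⇒chordal {suc _} {zero} _ _ = [] , [] , (λ _ ()) , tt
¬containsForbidden⇒chordal {suc _} {suc _} G-complete ¬forbidden
  with positiveAwayFrom-or-containsForbidden G-complete zero zero
... | inj₁ (_ , _ , positive) = positiveAwayFrom⇒chordal G-complete positive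
... | inj₂ forbidden = contradiction forbidden ¬forbidden

theorem2p2 : (m n : ℕ) (G : SBigraph m n) → IsComplete G →
    (IsChordal G → ¬ ContainsForbidden G) × (¬ ContainsForbidden G → IsChordal G)
theorem2p2 m n G G-complete =
  chordal⇒¬containsForbidden G-complete , ¬containsForbidden⇒chordal G-complete
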